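{- Let $d\ge 1$ be an integer and define $\kappa(d)\in\mathbb{R}\cup\{\infty\}$ to be the infimum of all real numbers $\kappa$ such that every bridgeless simplicial complex of dimension $d$ has a nowhere-zero $q$-flow for some positive integer $q\le \kappa$ (with $\inf\emptyset=\infty$). Then $\kappa(d)>d+2$.
   Context: All simplicial complexes are finite. For a simplicial complex $\Delta$ of dimension $d$, let $F$ be its set of $d$-simplices (facets) and $R$ its set of $(d-1)$-simplices (ridges); fix an orientation of each simplex and let $\partial\in\mathbb{Z}^{R\times F}$ be the simplicial boundary matrix. For a positive integer $q$, a $q$-flow of $\Delta$ is a vector $\varphi\in\{0,\dots,q-1\}^{F}$ with $\partial\varphi\equiv 0 \pmod q$; it is nowhere-zero if $\varphi\in\{1,\dots,q-1\}^F$. Homology is reduced homology and $\beta_n(Y)$ denotes the rank of $H_n(Y;\mathbb{Z})$. For $X\subseteq F$, $\Delta\setminus X$ denotes the subcomplex consisting of the facets in $F\setminus X$ together with all simplices of $\Delta$ of dimension at most $d-1$. A facet $f$ is a bridge if $\beta_{d-1}(\Delta\setminus\{f\})=\beta_{d-1}(\Delta)+1$; $\Delta$ is bridgeless if it has no bridge. -}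

module Defs where

open import Data.Nat as ℕ using (ℕ; zero; suc; _+_; _∸_; _≤_; _<_)
open import Data.Bool using (Bool; true; false; if_then_else_)
open import Data.Fin using (Fin; toℕ)
open import Data.Fin.Subset using (Subset; _⊆_; ∣_∣)
open import Data.Vec using (Vec; []; _∷_)
import Data.Vec.Properties as VP
open import Data.Bool.Properties using () renaming (_≟_ to _≟B_)
open import Data.Integer using (ℤ; +_; -_; _*_)
import Data.Integer as ℤ
open import Data.Integer.Divisibility using () renaming (_∣_ to _∣ℤ_)
open import Data.List using (List; length; filter; lookup)
open import Data.List.Membership.Propositional using (_∈_)
open import Data.List.Relation.Unary.Unique.Propositional using (Unique)
open import Data.List.Relation.Binary.Sublist.Propositional using () renaming (_⊆_ to _⊑_)
open import Relation.Nullary using (¬_; does; ¬?)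
open import Relation.Binary.PropositionalEquality using (_≡_; _≢_)
open import Data.Product using (Σ; Σ-syntax; ∃; ∃₂; _×_)

-- A simplex is a subset of Fin n (a Vec Bool n); its orientation is the
-- one induced by the natural order of the vertices.  The list of faces
-- contains the empty face (it is closed downwards), which is what makes
-- the boundary map in degree 0 the augmentation, i.e. gives REDUCED
-- homology.

record Complex : Set where
  field
    n      : ℕ
    faces  : List (Subset n)
    unique : Unique faces
    closed : ∀ {σ τ} → σ ∈ faces → τ ⊆ σ → τ ∈ faces

open Complex public

-- faces with k vertices (i.e. of dimension k - 1)
facesOfSize : (Δ : Complex) → ℕ → List (Subset (n Δ))
facesOfSize Δ k = filter (λ σ → ∣ σ ∣ ℕ.≟ k) (faces Δ)

HasDim : Complex → ℕ → Set
HasDim Δ d = (∀ {σ} → σ ∈ faces Δ → ∣ σ ∣ ≤ suc d)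
           × (Σ[ σ ∈ Subset (n Δ) ] (σ ∈ faces Δ × ∣ σ ∣ ≡ suc d))

facets : (Δ : Complex) → ℕ → List (Subset (n Δ))
facets Δ d = facesOfSize Δ (suc d)

ridges : (Δ : Complex) → ℕ → List (Subset (n Δ))
ridges Δ d = facesOfSize Δ d

-- Simplicial boundary coefficients:  ∂[v₀<…<v_k] = Σ (-1)^i [.. v̂ᵢ ..]
-- coeff r f = (-1)^i if r = f ∖ {vᵢ}, and 0 otherwise.

sgn : ℕ → ℤ
sgn zero    = + 1
sgn (suc c) = - sgn c

go : ∀ {m} → ℕ → Subset m → Subset m → ℤ
go c []          []          = + 0
go c (true ∷ r)  (true ∷ f)  = go (suc c) r f
go c (false ∷ r) (false ∷ f) = go c r f
go c (true ∷ r)  (false ∷ f) = + 0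
go c (false ∷ r) (true ∷ f)  =
  if does (VP.≡-dec _≟B_ r f) then sgn c else + 0

coeff : ∀ {m} → Subset m → Subset m → ℤ
coeff r f = go 0 r f

sumᶠ : ∀ {m} → (Fin m → ℤ) → ℤ
sumᶠ {zero}  g = + 0
sumᶠ {suc m} g = g Fin.zero ℤ.+ sumᶠ (λ i → g (Fin.suc i))
  where import Data.Fin as Fin

-- Rank (over ℚ, equivalently: maximal number of ℤ-linearly independent
-- columns) of the boundary matrix with rows indexed by rs, columns by cs.

Independent : ∀ {m} → List (Subset m) → List (Subset m) → Set
Independent rs cs =
  (c : Fin (length cs) → ℤ) →
  (∀ {r} → r ∈ rs → sumᶠ (λ i → c i * coeff r (lookup cs i)) ≡ + 0) →
  ∀ i → c i ≡ + 0

HasRank : ∀ {m} → List (Subset m) → List (Subset m) → ℕ → Set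
HasRank rs cs k =
  (Σ[ cs′ ∈ List _ ] (cs′ ⊑ cs × Independent rs cs′ × length cs′ ≡ k))
  × (∀ cs′ → cs′ ⊑ cs → Independent rs cs′ → length cs′ ≤ k)

-- β_{d-1} of the subcomplex of the d-complex Δ consisting of all faces of
-- dimension ≤ d-1 together with the facets in Fs:
--   β_{d-1} = |R| - rank ∂_{d-1} - rank ∂_d   (rank of H_{d-1}(·;ℤ)).
BettiRidge : (Δ : Complex) → ℕ → List (Subset (n Δ)) → ℕ → Set
BettiRidge Δ d Fs b =
  ∃₂ λ r₁ r₂ → HasRank (facesOfSize Δ (d ∸ 1)) (ridges Δ d) r₁
             × HasRank (ridges Δ d) Fs r₂
             × b + r₁ + r₂ ≡ length (ridges Δ d)

removeFacet : ∀ {m} → Subset m → List (Subset m) → List (Subset m)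
removeFacet f = filter (λ g → ¬? (VP.≡-dec _≟B_ g f))

IsBridge : (Δ : Complex) → ℕ → Subset (n Δ) → Set
IsBridge Δ d f =
  f ∈ facets Δ d ×
  (∃ λ b → BettiRidge Δ d (facets Δ d) b
         × BettiRidge Δ d (removeFacet f (facets Δ d)) (suc b))

Bridgeless : Complex → ℕ → Set
Bridgeless Δ d = ∀ f → ¬ IsBridge Δ d f

NZFlow : (Δ : Complex) → ℕ → ℕ → Set
NZFlow Δ d q =
  Σ[ φ ∈ (Fin (length (facets Δ d)) → Fin q) ]
    ((∀ i → toℕ (φ i) ≢ 0)
    × (∀ {r} → r ∈ ridges Δ d →
         (+ q) ∣ℤ sumᶠ (λ i → coeff r (lookup (facets Δ d) i) * + toℕ (φ i))))

-- κ is admissible for d: every bridgeless d-complex has a nowhere-zero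
-- q-flow for some positive integer q ≤ κ.  (Only integer κ are needed,
-- since q is an integer: real κ is admissible iff ⌊κ⌋ is.)
Admissible : ℕ → ℕ → Set
Admissible d κ =
  (Δ : Complex) → HasDim Δ d → Bridgeless Δ d →
  ∃ λ q → 1 ≤ q × q ≤ κ × NZFlow Δ d q

{-# OPTIONS --safe #-}
-- The counterexample is the d-skeleton Δ of the simplex on the vertex set V = {0, …, d + 2}.
--
-- Δ is bridgeless: a facet f lies in the boundary of the (d+1)-simplex f ∪ {u}, which is a
-- cycle since ∂∂ = 0, and a column lying in the support of a cycle can be exchanged out of any
-- maximal independent set of columns, so deleting it does not lower the rank of ∂.
--
-- Δ has no nowhere-zero q-flow for q ≤ d + 2: the facets of Δ are the complements of pairs of
-- vertices and its ridges the complements of triples, so a flow φ is, dually, a 1-cocycle on the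
-- complete graph K_{d+3}. With the potential b(x) = ± φ(V ∖ {0, x}), the flow condition at the
-- ridge V ∖ {0, u, v} says that φ(V ∖ {u, v}) ≡ ± (b(u) − b(v)) (mod q). If q < d + 3, two of the
-- d + 3 potentials agree modulo q, so some value of φ is divisible by q.
module Submission where

open import Defs
open import Data.Nat using (ℕ; _+_; _≤_; _<_)
open import Data.Nat as ℕ using (zero; suc; z≤n; s≤s)
import Data.Nat.Properties as ℕ
import Data.Nat.Divisibility as ℕ
open import Data.Bool using (true; false; if_then_else_)
open import Data.Bool.Properties using () renaming (_≟_ to _≟B_)
open import Data.Empty using (⊥; ⊥-elim)
open import Data.Fin as Fin using (Fin; toℕ)
open import Data.Fin.Patterns using (0F)
import Data.Fin.Properties as Fin
open import Data.Fin.Subset using (Subset; ∣_∣; inside; outside; ⊤)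
import Data.Fin.Subset.Properties as Subset
open import Data.Integer as ℤ using (ℤ; +_; -_)
import Data.Integer.Properties as ℤ
open import Data.Integer.DivMod using (_%ℕ_; _/ℕ_; a≡a%ℕn+[a/ℕn]*n; n%ℕd<d)
open import Data.Integer.Divisibility.Signed
  using (_∣_; divides; ∣ᵤ⇒∣; ∣⇒∣ᵤ; ∣n⇒∣m*n; ∣m∣n⇒∣m+n; ∣m⇒∣-m)
open import Data.Integer.Solver using (module +-*-Solver)
open import Data.List as List using (List; []; _∷_; _++_; length; lookup; foldr; filter)
import Data.List.Properties as List
open import Data.List.Membership.Propositional using (_∈_; _∉_)
open import Data.List.Membership.Propositional.Properties
  using (∈-lookup; ∈-allFin; ∈-map⁺; ∈-map⁻; ∈-++⁺ˡ; ∈-++⁺ʳ; ∈-filter⁺; ∈-filter⁻)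
import Data.List.Relation.Unary.All as All
import Data.List.Relation.Unary.AllPairs as AllPairs
open import Data.List.Relation.Unary.Any using (here; there)
import Data.List.Relation.Unary.Any as Any
import Data.List.Relation.Unary.Any.Properties as Any
open import Data.List.Relation.Unary.Unique.Propositional using (Unique)
import Data.List.Relation.Unary.Unique.Propositional.Properties as Unique
open import Data.List.Relation.Binary.Sublist.Propositional using ([]; _∷_; _∷ʳ_) renaming (_⊆_ to _⊑_)
open import Data.Product using (∃; _×_; _,_; proj₁; proj₂)
open import Data.Sum using (_⊎_; inj₁; inj₂)
open import Data.Vec as Vec using ([]; _∷_; _[_]≔_)
import Data.Vec.Properties as Vec
import Data.Vec.Functional as Vector
import Data.Vec.Functional.Properties as Vector
open import Function using (_∘_; const; case_of_)
open import Relation.Binary.Definitions using (tri<; tri≈; tri>)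
open import Relation.Binary.PropositionalEquality
  using (_≡_; _≢_; refl; sym; trans; cong; cong₂; subst; module ≡-Reasoning)
open import Relation.Nullary using (¬_; Dec; yes; no; ¬?)
open import Relation.Nullary.Decidable using (dec-true; decidable-stable)

open import Algebra.Properties.Semiring.Sum ℤ.+-*-semiring
  using (sum; sum-cong-≗; ∑-distrib-+; *-distribˡ-sum; sum-replicate-zero)
open +-*-Solver using (solve; _:+_; _:*_; _:-_; :-_; _:=_; con)

private
  variable
    m : ℕ

sgn*sgn≡1 : ∀ c → sgn c ℤ.* sgn c ≡ + 1
sgn*sgn≡1 zero    = refl
sgn*sgn≡1 (suc c) = trans (solve 1 (λ x → (:- x) :* (:- x) := x :* x) refl (sgn c)) (sgn*sgn≡1 c)

sgn≢0 : ∀ c → sgn c ≢ + 0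
sgn≢0 c sgn≡0 = case trans (sym (sgn*sgn≡1 c)) (cong (λ x → x ℤ.* x) sgn≡0) of λ ()

*≢0ˡ : ∀ a b → a ℤ.* b ≢ + 0 → a ≢ + 0
*≢0ˡ a b ab≢0 refl = ab≢0 refl

*≢0ʳ : ∀ a b → a ℤ.* b ≢ + 0 → b ≢ + 0
*≢0ʳ a b ab≢0 refl = ab≢0 (ℤ.*-zeroʳ a)

-- Cofaces and boundary coefficients

data _⋖⟨_⟩_ (r : Subset m) (k : Fin m) : Subset m → Set where
  add : Vec.lookup r k ≡ outside → r ⋖⟨ k ⟩ (r [ k ]≔ inside)

before : Subset m → Fin m → ℕ
before σ       Fin.zero    = 0
before (x ∷ σ) (Fin.suc k) = (if x then 1 else 0) + before σ k

go-insert : ∀ c (r : Subset m) k → Vec.lookup r k ≡ outside → go c r (r [ k ]≔ inside) ≡ sgn (c + before r k)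
go-insert c (false ∷ r) Fin.zero    refl
  rewrite dec-true (Vec.≡-dec _≟B_ r r) refl = cong sgn (sym (ℕ.+-identityʳ c))
go-insert c (true ∷ r)  (Fin.suc k) rk =
  trans (go-insert (suc c) r k rk) (cong sgn (sym (ℕ.+-suc c (before r k))))
go-insert c (false ∷ r) (Fin.suc k) rk = go-insert c r k rk

coeff-⋖ : {r σ : Subset m} {k : Fin m} → r ⋖⟨ k ⟩ σ → coeff r σ ≡ sgn (before r k)
coeff-⋖ {r = r} {k = k} (add rk) = go-insert 0 r k rk

go≢0⇒⋖ : ∀ c (r σ : Subset m) → go c r σ ≢ + 0 → ∃ λ k → r ⋖⟨ k ⟩ σ
go≢0⇒⋖ c []          []          go≢0 = ⊥-elim (go≢0 refl)
go≢0⇒⋖ c (true ∷ r)  (true ∷ σ)  go≢0 with go≢0⇒⋖ (suc c) r σ go≢0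
... | k , add rk = Fin.suc k , add rk
go≢0⇒⋖ c (false ∷ r) (false ∷ σ) go≢0 with go≢0⇒⋖ c r σ go≢0
... | k , add rk = Fin.suc k , add rk
go≢0⇒⋖ c (true ∷ r)  (false ∷ σ) go≢0 = ⊥-elim (go≢0 refl)
go≢0⇒⋖ c (false ∷ r) (true ∷ σ)  go≢0 with Vec.≡-dec _≟B_ r σ
... | yes refl = Fin.zero , add refl
... | no _     = ⊥-elim (go≢0 refl)

coeff≢0⇒⋖ : (r σ : Subset m) → coeff r σ ≢ + 0 → ∃ λ k → r ⋖⟨ k ⟩ σ
coeff≢0⇒⋖ = go≢0⇒⋖ 0

⋖-old : {r σ : Subset m} {k : Fin m} → r ⋖⟨ k ⟩ σ → Vec.lookup r k ≡ outside
⋖-old (add rk) = rk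

⋖-new : {r σ : Subset m} {k : Fin m} → r ⋖⟨ k ⟩ σ → Vec.lookup σ k ≡ inside
⋖-new {r = r} {k = k} (add _) = Vec.lookup∘update k r inside

⋖-lookup : {r σ : Subset m} {k j : Fin m} → r ⋖⟨ k ⟩ σ → j ≢ k → Vec.lookup σ j ≡ Vec.lookup r j
⋖-lookup {r = r} (add _) j≢k = Vec.lookup∘update′ j≢k r inside

⋖-inside : {r σ : Subset m} {k j : Fin m} → r ⋖⟨ k ⟩ σ → Vec.lookup σ j ≡ inside →
           j ≡ k ⊎ Vec.lookup r j ≡ inside
⋖-inside {k = k} {j} r⋖σ σj with j Fin.≟ k
... | yes j≡k = inj₁ j≡k
... | no  j≢k = inj₂ (trans (sym (⋖-lookup r⋖σ j≢k)) σj)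

⋖-keeps : {r σ : Subset m} {k j : Fin m} → r ⋖⟨ k ⟩ σ → Vec.lookup r j ≡ inside → Vec.lookup σ j ≡ inside
⋖-keeps {k = k} {j} r⋖σ rj with j Fin.≟ k
... | yes refl = ⋖-new r⋖σ
... | no  j≢k  = trans (⋖-lookup r⋖σ j≢k) rj

⋖-functional : {r σ σ′ : Subset m} {k : Fin m} → r ⋖⟨ k ⟩ σ → r ⋖⟨ k ⟩ σ′ → σ ≡ σ′
⋖-functional (add _) (add _) = refl

⋖-vertex-unique : {r σ : Subset m} {k k′ : Fin m} → r ⋖⟨ k ⟩ σ → r ⋖⟨ k′ ⟩ σ → k ≡ k′
⋖-vertex-unique {k = k} {k′} r⋖σ r⋖′σ with k′ Fin.≟ k
... | yes k′≡k = sym k′≡k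
... | no  k′≢k = case trans (sym (⋖-new r⋖′σ)) (trans (⋖-lookup r⋖σ k′≢k) (⋖-old r⋖′σ)) of λ ()

⋖⋖-distinct : {r σ τ : Subset m} {j k : Fin m} → r ⋖⟨ j ⟩ σ → σ ⋖⟨ k ⟩ τ → j ≢ k
⋖⋖-distinct r⋖σ σ⋖τ refl = case trans (sym (⋖-new r⋖σ)) (⋖-old σ⋖τ) of λ ()

⋖-remove : (σ : Subset m) (k : Fin m) → Vec.lookup σ k ≡ inside → (σ [ k ]≔ outside) ⋖⟨ k ⟩ σ
⋖-remove σ k σk = subst ((σ [ k ]≔ outside) ⋖⟨ k ⟩_) restore (add (Vec.lookup∘update k σ outside))
  where
  open ≡-Reasoning
  restore : σ [ k ]≔ outside [ k ]≔ inside ≡ σ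
  restore = begin
    σ [ k ]≔ outside [ k ]≔ inside  ≡⟨ Vec.[]≔-idempotent σ k ⟩
    σ [ k ]≔ inside                 ≡⟨ cong (σ [ k ]≔_) σk ⟨
    σ [ k ]≔ Vec.lookup σ k         ≡⟨ Vec.[]≔-lookup σ k ⟩
    σ                               ∎

⋖-commute : {r σ₀ τ : Subset m} {j k : Fin m} → r ⋖⟨ j ⟩ σ₀ → σ₀ ⋖⟨ k ⟩ τ →
            ∃ λ σ₁ → r ⋖⟨ k ⟩ σ₁ × σ₁ ⋖⟨ j ⟩ τ
⋖-commute {r = r} {j = j} {k} r⋖σ₀@(add rj) σ₀⋖τ@(add σ₀k) =
  r [ k ]≔ inside , add rk , subst (_ ⋖⟨ j ⟩_) (Vec.[]≔-commutes r k j k≢j) (add σ₁j)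
  where
  k≢j : k ≢ j
  k≢j = ⋖⋖-distinct r⋖σ₀ σ₀⋖τ ∘ sym
  rk : Vec.lookup r k ≡ outside
  rk = trans (sym (⋖-lookup r⋖σ₀ k≢j)) σ₀k
  σ₁j : Vec.lookup (r [ k ]≔ inside) j ≡ outside
  σ₁j = trans (Vec.lookup∘update′ (k≢j ∘ sym) r inside) rj

⋖⋖-vertex : {r σ₀ σ τ : Subset m} {j k j′ k′ : Fin m} → r ⋖⟨ j ⟩ σ₀ → σ₀ ⋖⟨ k ⟩ τ →
            r ⋖⟨ j′ ⟩ σ → σ ⋖⟨ k′ ⟩ τ → j′ ≡ j ⊎ j′ ≡ k
⋖⋖-vertex r⋖σ₀ σ₀⋖τ r⋖σ σ⋖τ with ⋖-inside σ₀⋖τ (⋖-keeps σ⋖τ (⋖-new r⋖σ))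
... | inj₁ j′≡k = inj₂ j′≡k
... | inj₂ σ₀j′ with ⋖-inside r⋖σ₀ σ₀j′
...   | inj₁ j′≡j = inj₁ j′≡j
...   | inj₂ rj′  = case trans (sym (⋖-old r⋖σ)) rj′ of λ ()

∣⋖∣ : {r σ : Subset m} {k : Fin m} → r ⋖⟨ k ⟩ σ → ∣ σ ∣ ≡ suc ∣ r ∣
∣⋖∣ {r = false ∷ r} {k = Fin.zero}  (add refl) = refl
∣⋖∣ {r = true ∷ r}  {k = Fin.suc k} (add rk)   = cong suc (∣⋖∣ (add {r = r} rk))
∣⋖∣ {r = false ∷ r} {k = Fin.suc k} (add rk)   = ∣⋖∣ (add {r = r} rk)

before-⋖-≤ : {r σ : Subset m} {k : Fin m} (j : Fin m) → r ⋖⟨ k ⟩ σ → toℕ j ≤ toℕ k →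
             before σ j ≡ before r j
before-⋖-≤ Fin.zero _ _ = refl
before-⋖-≤ {r = x ∷ r} {k = Fin.suc k} (Fin.suc j) (add rk) (s≤s j≤k) =
  cong (λ b → (if x then 1 else 0) + b) (before-⋖-≤ j (add {r = r} rk) j≤k)

before-⋖-> : {r σ : Subset m} {k : Fin m} (j : Fin m) → r ⋖⟨ k ⟩ σ → toℕ k < toℕ j →
             before σ j ≡ suc (before r j)
before-⋖-> {r = false ∷ r} {k = Fin.zero}  (Fin.suc j) (add refl) _ = refl
before-⋖-> {r = x ∷ r}     {k = Fin.suc k} (Fin.suc j) (add rk) (s≤s k<j) =
  trans (cong (λ b → (if x then 1 else 0) + b) (before-⋖-> j (add {r = r} rk) k<j)) (ℕ.+-suc _ _)

before-⊤ : (k : Fin m) → before ⊤ k ≡ toℕ k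
before-⊤ Fin.zero    = refl
before-⊤ (Fin.suc k) = cong suc (before-⊤ k)

∃-outside : (p : Subset m) → ∣ p ∣ < m → ∃ λ k → Vec.lookup p k ≡ outside
∃-outside (false ∷ p) _ = Fin.zero , refl
∃-outside (true ∷ p) (s≤s ∣p∣<m) with ∃-outside p ∣p∣<m
... | k , pk = Fin.suc k , pk

∂∂-diamond-< : {r σ₀ σ₁ τ : Subset m} {j k : Fin m} →
               r ⋖⟨ j ⟩ σ₀ → σ₀ ⋖⟨ k ⟩ τ → r ⋖⟨ k ⟩ σ₁ → σ₁ ⋖⟨ j ⟩ τ → toℕ k < toℕ j →
               coeff σ₀ τ ℤ.* coeff r σ₀ ℤ.+ coeff σ₁ τ ℤ.* coeff r σ₁ ≡ + 0
∂∂-diamond-< {r = r} {σ₀} {σ₁} {τ} {j} {k} r⋖σ₀ σ₀⋖τ r⋖σ₁ σ₁⋖τ k<j = begin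
  coeff σ₀ τ ℤ.* coeff r σ₀ ℤ.+ coeff σ₁ τ ℤ.* coeff r σ₁
    ≡⟨ cong₂ ℤ._+_ (cong₂ ℤ._*_ σ₀τ (coeff-⋖ r⋖σ₀)) (cong₂ ℤ._*_ σ₁τ (coeff-⋖ r⋖σ₁)) ⟩
  a ℤ.* b ℤ.+ (- b) ℤ.* a
    ≡⟨ solve 2 (λ a b → a :* b :+ (:- b) :* a := con (+ 0)) refl a b ⟩
  + 0 ∎
  where
  open ≡-Reasoning
  a = sgn (before r k)
  b = sgn (before r j)
  σ₀τ : coeff σ₀ τ ≡ a
  σ₀τ = trans (coeff-⋖ σ₀⋖τ) (cong sgn (before-⋖-≤ k r⋖σ₀ (ℕ.<⇒≤ k<j)))
  σ₁τ : coeff σ₁ τ ≡ - b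
  σ₁τ = trans (coeff-⋖ σ₁⋖τ) (cong sgn (before-⋖-> j r⋖σ₁ k<j))

∂∂-diamond : {r σ₀ σ₁ τ : Subset m} {j k : Fin m} →
             r ⋖⟨ j ⟩ σ₀ → σ₀ ⋖⟨ k ⟩ τ → r ⋖⟨ k ⟩ σ₁ → σ₁ ⋖⟨ j ⟩ τ →
             coeff σ₀ τ ℤ.* coeff r σ₀ ℤ.+ coeff σ₁ τ ℤ.* coeff r σ₁ ≡ + 0
∂∂-diamond {r = r} {σ₀} {σ₁} {τ} {j} {k} r⋖σ₀ σ₀⋖τ r⋖σ₁ σ₁⋖τ with Fin.<-cmp k j
... | tri< k<j _ _ = ∂∂-diamond-< r⋖σ₀ σ₀⋖τ r⋖σ₁ σ₁⋖τ k<j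
... | tri> _ _ j<k =
  trans (ℤ.+-comm (coeff σ₀ τ ℤ.* coeff r σ₀) _) (∂∂-diamond-< r⋖σ₁ σ₁⋖τ r⋖σ₀ σ₀⋖τ j<k)
... | tri≈ _ k≡j _ = ⊥-elim (⋖⋖-distinct r⋖σ₀ σ₀⋖τ (sym k≡j))

sumᶠ≡sum : (g : Fin m → ℤ) → sumᶠ g ≡ sum g
sumᶠ≡sum {zero}  g = refl
sumᶠ≡sum {suc m} g = cong (ℤ._+_ (g Fin.zero)) (sumᶠ≡sum (g ∘ Fin.suc))

sumᶠ-cong : {g h : Fin m → ℤ} → (∀ i → g i ≡ h i) → sumᶠ g ≡ sumᶠ h
sumᶠ-cong {g = g} {h} g≗h = trans (sumᶠ≡sum g) (trans (sum-cong-≗ g≗h) (sym (sumᶠ≡sum h)))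

sumᶠ-zero : (g : Fin m → ℤ) → (∀ i → g i ≡ + 0) → sumᶠ g ≡ + 0
sumᶠ-zero {m} g g≗0 = trans (sumᶠ≡sum g) (trans (sum-cong-≗ g≗0) (sum-replicate-zero m))

sumᶠ-pick : (g : Fin m → ℤ) (j : Fin m) → sumᶠ g ≡ g j ℤ.+ sumᶠ (Vector.updateAt g j (const (+ 0)))
sumᶠ-pick g Fin.zero    = cong (ℤ._+_ (g Fin.zero)) (sym (ℤ.+-identityˡ _))
sumᶠ-pick g (Fin.suc j) = trans (cong (ℤ._+_ (g Fin.zero)) (sumᶠ-pick (g ∘ Fin.suc) j))
  (solve 3 (λ x y z → x :+ (y :+ z) := y :+ (x :+ z)) refl (g Fin.zero) (g (Fin.suc j)) _)

sumᶠ-support : (g : Fin m → ℤ) {is : List (Fin m)} → Unique is → (∀ i → g i ≢ + 0 → i ∈ is) →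
               sumᶠ g ≡ foldr ℤ._+_ (+ 0) (List.map g is)
sumᶠ-support g {[]}     _ supp =
  sumᶠ-zero g λ i → decidable-stable (g i ℤ.≟ + 0) (λ gi≢0 → case supp i gi≢0 of λ ())
sumᶠ-support g {j ∷ is} (j∉is AllPairs.∷ distinct) supp = begin
  sumᶠ g                                      ≡⟨ sumᶠ-pick g j ⟩
  g j ℤ.+ sumᶠ g₀                             ≡⟨ cong (ℤ._+_ (g j)) (sumᶠ-support g₀ distinct supp₀) ⟩
  g j ℤ.+ foldr ℤ._+_ (+ 0) (List.map g₀ is)  ≡⟨ cong (λ xs → g j ℤ.+ foldr ℤ._+_ (+ 0) xs)
                                                      (List.map-cong-local (All.map g₀≡g j∉is)) ⟩
  g j ℤ.+ foldr ℤ._+_ (+ 0) (List.map g is)   ∎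
  where
  open ≡-Reasoning
  g₀ = Vector.updateAt g j (const (+ 0))
  g₀≡g : ∀ {i} → j ≢ i → g₀ i ≡ g i
  g₀≡g j≢i = Vector.updateAt-minimal _ j g (j≢i ∘ sym)
  supp₀ : ∀ i → g₀ i ≢ + 0 → i ∈ is
  supp₀ i g₀i≢0 with j Fin.≟ i
  ... | yes refl = ⊥-elim (g₀i≢0 (Vector.updateAt-updates j g))
  ... | no  j≢i with supp i (g₀i≢0 ∘ trans (g₀≡g j≢i))
  ...   | here i≡j   = ⊥-elim (j≢i (sym i≡j))
  ...   | there i∈is = i∈is

-- Sublists as masks

lookup-injective : {A : Set} {xs : List A} → Unique xs → (i j : Fin (length xs)) → lookup xs i ≡ lookup xs j → i ≡ j
lookup-injective {xs = _ ∷ _} _ Fin.zero Fin.zero _ = refl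
lookup-injective {xs = _ ∷ _} (x∉xs AllPairs.∷ _) Fin.zero (Fin.suc j) eq =
  ⊥-elim (All.lookup x∉xs (∈-lookup j) eq)
lookup-injective {xs = _ ∷ _} (x∉xs AllPairs.∷ _) (Fin.suc i) Fin.zero eq =
  ⊥-elim (All.lookup x∉xs (∈-lookup i) (sym eq))
lookup-injective {xs = _ ∷ _} (_ AllPairs.∷ distinct) (Fin.suc i) (Fin.suc j) eq =
  cong Fin.suc (lookup-injective distinct i j eq)

unique-pair : {A : Set} {a b : A} → a ≢ b → Unique (a ∷ b ∷ [])
unique-pair a≢b = (a≢b All.∷ All.[]) AllPairs.∷ All.[] AllPairs.∷ AllPairs.[]

unique-triple : {A : Set} {a b c : A} → a ≢ b → a ≢ c → b ≢ c → Unique (a ∷ b ∷ c ∷ [])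
unique-triple a≢b a≢c b≢c = (a≢b All.∷ a≢c All.∷ All.[]) AllPairs.∷ unique-pair b≢c

module _ {A : Set} where

  mask : {cs F : List A} → cs ⊑ F → Subset (length F)
  mask []       = []
  mask (_ ∷ʳ p) = outside ∷ mask p
  mask (_ ∷ p)  = inside ∷ mask p

  ∣mask∣ : {cs F : List A} (p : cs ⊑ F) → ∣ mask p ∣ ≡ length cs
  ∣mask∣ []       = refl
  ∣mask∣ (_ ∷ʳ p) = ∣mask∣ p
  ∣mask∣ (_ ∷ p)  = cong suc (∣mask∣ p)

  embed : {cs F : List A} → cs ⊑ F → Fin (length cs) → Fin (length F)
  embed (_ ∷ʳ p) i           = Fin.suc (embed p i)
  embed (_ ∷ p)  Fin.zero    = Fin.zero
  embed (_ ∷ p)  (Fin.suc i) = Fin.suc (embed p i)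

  extend : {cs F : List A} → cs ⊑ F → (Fin (length cs) → ℤ) → Fin (length F) → ℤ
  extend (_ ∷ʳ p) c Fin.zero    = + 0
  extend (_ ∷ʳ p) c (Fin.suc i) = extend p c i
  extend (_ ∷ p)  c Fin.zero    = c Fin.zero
  extend (_ ∷ p)  c (Fin.suc i) = extend p (c ∘ Fin.suc) i

  extend-embed : {cs F : List A} (p : cs ⊑ F) (c : Fin (length cs) → ℤ) (i : Fin (length cs)) →
                 extend p c (embed p i) ≡ c i
  extend-embed (_ ∷ʳ p) c i           = extend-embed p c i
  extend-embed (_ ∷ p)  c Fin.zero    = refl
  extend-embed (_ ∷ p)  c (Fin.suc i) = extend-embed p (c ∘ Fin.suc) i

  extend-outside : {cs F : List A} (p : cs ⊑ F) (c : Fin (length cs) → ℤ) (i : Fin (length F)) →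
                   Vec.lookup (mask p) i ≡ outside → extend p c i ≡ + 0
  extend-outside (_ ∷ʳ p) c Fin.zero    _  = refl
  extend-outside (_ ∷ʳ p) c (Fin.suc i) pi = extend-outside p c i pi
  extend-outside (_ ∷ p)  c (Fin.suc i) pi = extend-outside p (c ∘ Fin.suc) i pi

  extend-restrict : {cs F : List A} (p : cs ⊑ F) (w : Fin (length F) → ℤ) →
                    (∀ i → Vec.lookup (mask p) i ≡ outside → w i ≡ + 0) → ∀ i → extend p (w ∘ embed p) i ≡ w i
  extend-restrict (_ ∷ʳ p) w supp Fin.zero    = sym (supp Fin.zero refl)
  extend-restrict (_ ∷ʳ p) w supp (Fin.suc i) = extend-restrict p (w ∘ Fin.suc) (supp ∘ Fin.suc) i
  extend-restrict (_ ∷ p)  w supp Fin.zero    = refl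
  extend-restrict (_ ∷ p)  w supp (Fin.suc i) = extend-restrict p (w ∘ Fin.suc) (supp ∘ Fin.suc) i

  extend-zero : {cs F : List A} (p : cs ⊑ F) (c : Fin (length cs) → ℤ) →
                (∀ k → c k ≡ + 0) → ∀ i → extend p c i ≡ + 0
  extend-zero (_ ∷ʳ p) c c≗0 Fin.zero    = refl
  extend-zero (_ ∷ʳ p) c c≗0 (Fin.suc i) = extend-zero p c c≗0 i
  extend-zero (_ ∷ p)  c c≗0 Fin.zero    = c≗0 Fin.zero
  extend-zero (_ ∷ p)  c c≗0 (Fin.suc i) = extend-zero p (c ∘ Fin.suc) (c≗0 ∘ Fin.suc) i

  sumᶠ-extend : {cs F : List A} (p : cs ⊑ F) (c : Fin (length cs) → ℤ) (h : A → ℤ) →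
                sumᶠ (λ i → extend p c i ℤ.* h (lookup F i)) ≡ sumᶠ (λ i → c i ℤ.* h (lookup cs i))
  sumᶠ-extend []         c h = refl
  sumᶠ-extend (_ ∷ʳ p)   c h = trans (ℤ.+-identityˡ _) (sumᶠ-extend p c h)
  sumᶠ-extend (refl ∷ p) c h = cong (ℤ._+_ (c Fin.zero ℤ.* _)) (sumᶠ-extend p (c ∘ Fin.suc) h)

  select : (F : List A) → Subset (length F) → List A
  select []      []            = []
  select (x ∷ F) (inside ∷ M)  = x ∷ select F M
  select (x ∷ F) (outside ∷ M) = select F M

  select-⊑ : (F : List A) (M : Subset (length F)) → select F M ⊑ F
  select-⊑ []      []            = []
  select-⊑ (x ∷ F) (inside ∷ M)  = refl ∷ select-⊑ F M
  select-⊑ (x ∷ F) (outside ∷ M) = x ∷ʳ select-⊑ F M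

  mask-select : (F : List A) (M : Subset (length F)) → mask (select-⊑ F M) ≡ M
  mask-select []      []            = refl
  mask-select (x ∷ F) (inside ∷ M)  = cong (inside ∷_) (mask-select F M)
  mask-select (x ∷ F) (outside ∷ M) = cong (outside ∷_) (mask-select F M)

  length-select : (F : List A) (M : Subset (length F)) → length (select F M) ≡ ∣ M ∣
  length-select F M = trans (sym (∣mask∣ (select-⊑ F M))) (cong ∣_∣ (mask-select F M))

select-⊑-removeFacet : (f : Subset m) (F : List (Subset m)) (M : Subset (length F)) →
                       (∀ i → Vec.lookup M i ≡ inside → lookup F i ≢ f) → select F M ⊑ removeFacet f F
select-⊑-removeFacet f []      []      _      = []
select-⊑-removeFacet f (x ∷ F) (b ∷ M) avoids with Vec.≡-dec _≟B_ x f | b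
... | yes x≡f | inside  = ⊥-elim (avoids Fin.zero refl x≡f)
... | yes _   | outside = select-⊑-removeFacet f F M (avoids ∘ Fin.suc)
... | no _    | inside  = refl ∷ select-⊑-removeFacet f F M (avoids ∘ Fin.suc)
... | no _    | outside = x ∷ʳ select-⊑-removeFacet f F M (avoids ∘ Fin.suc)

-- Independent columns of the boundary matrix

HasRank-unique : {rs cs : List (Subset m)} {k k′ : ℕ} → HasRank rs cs k → HasRank rs cs k′ → k ≡ k′
HasRank-unique ((cs , p , indep , refl) , maximal) ((cs′ , p′ , indep′ , refl) , maximal′) =
  ℕ.≤-antisym (maximal′ cs p indep) (maximal cs′ p′ indep′)

module Columns (rs F : List (Subset m)) where

  Column : Set
  Column = Fin (length F)

  IsCycle : (Column → ℤ) → Set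
  IsCycle w = ∀ {r} → r ∈ rs → sumᶠ (λ i → w i ℤ.* coeff r (lookup F i)) ≡ + 0

  isCycle-combination : ∀ a b {w w′ : Column → ℤ} → IsCycle w → IsCycle w′ →
                        IsCycle (λ i → a ℤ.* w i ℤ.+ b ℤ.* w′ i)
  isCycle-combination a b {w} {w′} cycle cycle′ {r} r∈rs = begin
    sumᶠ (λ i → (a ℤ.* w i ℤ.+ b ℤ.* w′ i) ℤ.* c i)
      ≡⟨ sumᶠ≡sum (λ i → (a ℤ.* w i ℤ.+ b ℤ.* w′ i) ℤ.* c i) ⟩
    sum (λ i → (a ℤ.* w i ℤ.+ b ℤ.* w′ i) ℤ.* c i)
      ≡⟨ sum-cong-≗ (λ i → solve 5 (λ a b x y c → (a :* x :+ b :* y) :* c := a :* (x :* c) :+ b :* (y :* c))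
                                   refl a b (w i) (w′ i) (c i)) ⟩
    sum (λ i → a ℤ.* (w i ℤ.* c i) ℤ.+ b ℤ.* (w′ i ℤ.* c i))
      ≡⟨ ∑-distrib-+ (λ i → a ℤ.* (w i ℤ.* c i)) (λ i → b ℤ.* (w′ i ℤ.* c i)) ⟩
    sum (λ i → a ℤ.* (w i ℤ.* c i)) ℤ.+ sum (λ i → b ℤ.* (w′ i ℤ.* c i))
      ≡⟨ cong₂ ℤ._+_ (*-distribˡ-sum a (λ i → w i ℤ.* c i)) (*-distribˡ-sum b (λ i → w′ i ℤ.* c i)) ⟨
    a ℤ.* sum (λ i → w i ℤ.* c i) ℤ.+ b ℤ.* sum (λ i → w′ i ℤ.* c i)
      ≡⟨ cong₂ (λ x y → a ℤ.* x ℤ.+ b ℤ.* y) (vanishes w cycle) (vanishes w′ cycle′) ⟩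
    a ℤ.* + 0 ℤ.+ b ℤ.* + 0
      ≡⟨ solve 2 (λ a b → a :* con (+ 0) :+ b :* con (+ 0) := con (+ 0)) refl a b ⟩
    + 0 ∎
    where
    open ≡-Reasoning
    c : Column → ℤ
    c i = coeff r (lookup F i)
    vanishes : ∀ v → IsCycle v → sum (λ i → v i ℤ.* c i) ≡ + 0
    vanishes v cycleᵛ = trans (sym (sumᶠ≡sum (λ i → v i ℤ.* c i))) (cycleᵛ r∈rs)

  Supported : Subset (length F) → (Column → ℤ) → Set
  Supported M w = ∀ i → Vec.lookup M i ≡ outside → w i ≡ + 0

  IndependentOn : Subset (length F) → Set
  IndependentOn M = ∀ w → Supported M w → IsCycle w → ∀ i → w i ≡ + 0

  Independent⇒IndependentOn : {cs : List (Subset m)} (p : cs ⊑ F) → Independent rs cs → IndependentOn (mask p)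
  Independent⇒IndependentOn p indep w supp cycle i = begin
    w i                       ≡⟨ extend-restrict p w supp i ⟨
    extend p (w ∘ embed p) i  ≡⟨ extend-zero p (w ∘ embed p) restriction≡0 i ⟩
    + 0                       ∎
    where
    open ≡-Reasoning
    restriction≡0 : ∀ k → w (embed p k) ≡ + 0
    restriction≡0 = indep (w ∘ embed p) λ {r} r∈rs →
      trans (sym (sumᶠ-extend p (w ∘ embed p) (coeff r)))
            (trans (sumᶠ-cong (λ i → cong (ℤ._* coeff r (lookup F i)) (extend-restrict p w supp i))) (cycle r∈rs))

  IndependentOn⇒Independent : {cs : List (Subset m)} (p : cs ⊑ F) → IndependentOn (mask p) → Independent rs cs
  IndependentOn⇒Independent p indep c cycle k = begin
    c k                     ≡⟨ extend-embed p c k ⟨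
    extend p c (embed p k)  ≡⟨ indep (extend p c) (extend-outside p c) extension-isCycle (embed p k) ⟩
    + 0                     ∎
    where
    open ≡-Reasoning
    extension-isCycle : IsCycle (extend p c)
    extension-isCycle {r} r∈rs = trans (sumᶠ-extend p c (coeff r)) (cycle r∈rs)

  independentOn-≤-rank-without : Unique F → {j : Column} {k : ℕ} → HasRank rs (removeFacet (lookup F j) F) k →
                                 (M : Subset (length F)) → Vec.lookup M j ≡ outside → IndependentOn M → ∣ M ∣ ≤ k
  independentOn-≤-rank-without F-unique {j} (_ , maximal) M Mj independent =
    subst (_≤ _) (length-select F M)
      (maximal (select F M) (select-⊑-removeFacet (lookup F j) F M avoids-j)
        (IndependentOn⇒Independent (select-⊑ F M) (subst IndependentOn (sym (mask-select F M)) independent)))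
    where
    avoids-j : ∀ i → Vec.lookup M i ≡ inside → lookup F i ≢ lookup F j
    avoids-j i Mi Fi≡Fj with lookup-injective F-unique i j Fi≡Fj
    ... | refl = case trans (sym Mi) Mj of λ ()

  eliminate-column : {w D : Column → ℤ} {j g : Column} → IsCycle w → IsCycle D →
                     w j ≢ + 0 → D j ≡ + 0 → D g ≢ + 0 →
                     ∃ λ w′ → IsCycle w′ × w′ j ≢ + 0 × w′ g ≡ + 0 ×
                              (∀ i → w i ≡ + 0 → D i ≡ + 0 → w′ i ≡ + 0)
  eliminate-column {w} {D} {j} {g} cycleʷ cycleᴰ wj≢0 Dj≡0 Dg≢0 =
    w′ , isCycle-combination (D g) (- w g) cycleʷ cycleᴰ , w′j≢0 ,
    solve 2 (λ a b → a :* b :+ (:- b) :* a := con (+ 0)) refl (D g) (w g) ,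
    λ i wi≡0 Di≡0 → trans (cong₂ (λ x y → D g ℤ.* x ℤ.+ (- w g) ℤ.* y) wi≡0 Di≡0)
                          (solve 2 (λ a b → a :* con (+ 0) :+ (:- b) :* con (+ 0) := con (+ 0)) refl (D g) (w g))
    where
    w′ : Column → ℤ
    w′ k = D g ℤ.* w k ℤ.+ (- w g) ℤ.* D k
    w′j≡ : w′ j ≡ D g ℤ.* w j
    w′j≡ = trans (cong (λ x → D g ℤ.* w j ℤ.+ (- w g) ℤ.* x) Dj≡0)
                 (solve 3 (λ a b c → a :* b :+ (:- c) :* con (+ 0) := a :* b) refl (D g) (w j) (w g))
    w′j≢0 : w′ j ≢ + 0
    w′j≢0 w′j≡0 with ℤ.i*j≡0⇒i≡0∨j≡0 (D g) (trans (sym w′j≡) w′j≡0)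
    ... | inj₁ Dg≡0 = Dg≢0 Dg≡0
    ... | inj₂ wj≡0 = wj≢0 wj≡0

  -- Run through the columns g outside M. Unless M − j + g is independent, some cycle D supported
  -- on it has D g ≠ 0 (otherwise D is supported on M), and subtracting a multiple of D from z kills
  -- its g-coordinate but keeps z j ≠ 0. At the end z is a cycle supported on M with z j ≠ 0.
  exchange : {M₀ M : Subset (length F)} {j : Column} {z : Column → ℤ} →
             M₀ ⋖⟨ j ⟩ M → IndependentOn M → IsCycle z → z j ≢ + 0 →
             ¬ (∀ {g M′} → g ≢ j → M₀ ⋖⟨ g ⟩ M′ → ¬ IndependentOn M′)
  exchange {M₀} {M} {j} {z} M₀⋖M independent cycle zj≢0 noExchange =
    eliminate (List.allFin _) z cycle zj≢0 (λ i _ i∉ → ⊥-elim (i∉ (∈-allFin i)))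
    where
    eliminate : ∀ is w → IsCycle w → w j ≢ + 0 →
                (∀ i → Vec.lookup M i ≡ outside → i ∉ is → w i ≡ + 0) → ⊥
    eliminate []       w cycleʷ wj≢0 supp = wj≢0 (independent w (λ i Mi → supp i Mi λ ()) cycleʷ j)
    eliminate (g ∷ is) w cycleʷ wj≢0 supp with Vec.lookup M g in Mg
    ... | inside  = eliminate is w cycleʷ wj≢0 λ i Mi i∉is → supp i Mi λ
                      { (here refl) → case trans (sym Mi) Mg of λ ()
                      ; (there i∈is) → i∉is i∈is }
    ... | outside = noExchange g≢j M₀⋖M′ independent′
      where
      g≢j : g ≢ j
      g≢j refl = case trans (sym Mg) (⋖-new M₀⋖M) of λ ()
      M₀⋖M′ : M₀ ⋖⟨ g ⟩ (M₀ [ g ]≔ inside)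
      M₀⋖M′ = add (trans (sym (⋖-lookup M₀⋖M g≢j)) Mg)
      outside′ : ∀ {i} → Vec.lookup M i ≡ outside → i ≢ g → Vec.lookup (M₀ [ g ]≔ inside) i ≡ outside
      outside′ {i} Mi i≢g with i Fin.≟ j
      ... | yes refl = case trans (sym Mi) (⋖-new M₀⋖M) of λ ()
      ... | no  i≢j  = trans (⋖-lookup M₀⋖M′ i≢g) (trans (sym (⋖-lookup M₀⋖M i≢j)) Mi)
      independent′ : IndependentOn (M₀ [ g ]≔ inside)
      independent′ D suppᴰ cycleᴰ i with D g ℤ.≟ + 0
      ... | yes Dg≡0 = independent D suppᴹ cycleᴰ i
        where
        suppᴹ : Supported M D
        suppᴹ k Mk with k Fin.≟ g
        ... | yes refl = Dg≡0
        ... | no  k≢g  = suppᴰ k (outside′ Mk k≢g)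
      ... | no  Dg≢0 with eliminate-column cycleʷ cycleᴰ wj≢0 Dj≡0 Dg≢0
        where
        Dj≡0 : D j ≡ + 0
        Dj≡0 = suppᴰ j (trans (⋖-lookup M₀⋖M′ (g≢j ∘ sym)) (⋖-old M₀⋖M))
      ...   | w′ , cycle′ , w′j≢0 , w′g≡0 , w′-vanishes = ⊥-elim (eliminate is w′ cycle′ w′j≢0 supp′)
        where
        supp′ : ∀ i → Vec.lookup M i ≡ outside → i ∉ is → w′ i ≡ + 0
        supp′ i Mi i∉is with i Fin.≟ g
        ... | yes refl = w′g≡0
        ... | no  i≢g  = w′-vanishes i (supp i Mi λ { (here i≡g) → i≢g i≡g ; (there i∈is) → i∉is i∈is })
                                       (suppᴰ i (outside′ Mi i≢g))

  cycle-column-keeps-rank : Unique F → (z : Column → ℤ) {j : Column} → IsCycle z → z j ≢ + 0 →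
                            {k : ℕ} → HasRank rs F (suc k) → ¬ HasRank rs (removeFacet (lookup F j) F) k
  cycle-column-keeps-rank F-unique z {j} cycle zj≢0 {k} ((cs , cs⊑F , indep , ∣cs∣) , _) rank-without =
    by-cases (Vec.lookup M j) refl
    where
    M = mask cs⊑F
    independent : IndependentOn M
    independent = Independent⇒IndependentOn cs⊑F indep
    too-large : ∀ M′ → Vec.lookup M′ j ≡ outside → IndependentOn M′ → ∣ M′ ∣ ≡ ∣ M ∣ → ⊥
    too-large M′ M′j independent′ ∣M′∣≡∣M∣ = ℕ.<-irrefl refl
      (subst (_≤ k) (trans ∣M′∣≡∣M∣ (trans (∣mask∣ cs⊑F) ∣cs∣))
             (independentOn-≤-rank-without F-unique rank-without M′ M′j independent′))
    by-cases : ∀ b → Vec.lookup M j ≡ b → ⊥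
    by-cases outside Mj = too-large M Mj independent refl
    by-cases inside  Mj = exchange {z = z} M₀⋖M independent cycle zj≢0 λ {_} {M′} g≢j M₀⋖M′ independent′ →
      too-large M′ (trans (⋖-lookup M₀⋖M′ (g≢j ∘ sym)) (⋖-old M₀⋖M)) independent′
                  (trans (∣⋖∣ M₀⋖M′) (sym (∣⋖∣ M₀⋖M)))
      where
      M₀⋖M : (M [ j ]≔ outside) ⋖⟨ j ⟩ M
      M₀⋖M = ⋖-remove M j Mj

coface-index : {r σ : Subset m} {k : Fin m} {F : List (Subset m)} → Unique F → (σ∈F : σ ∈ F) → r ⋖⟨ k ⟩ σ →
               {i : Fin (length F)} → r ⋖⟨ k ⟩ lookup F i → i ≡ Any.index σ∈F
coface-index F-unique σ∈F r⋖σ {i} r⋖Fi =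
  lookup-injective F-unique i (Any.index σ∈F) (trans (⋖-functional r⋖Fi r⋖σ) (Any.lookup-index σ∈F))

coface-index-distinct : {r σ σ′ : Subset m} {k k′ : Fin m} {F : List (Subset m)}
                        (σ∈F : σ ∈ F) (σ′∈F : σ′ ∈ F) →
                        r ⋖⟨ k ⟩ σ → r ⋖⟨ k′ ⟩ σ′ → k ≢ k′ → Any.index σ∈F ≢ Any.index σ′∈F
coface-index-distinct {r = r} {k′ = k′} {F} σ∈F σ′∈F r⋖σ r⋖σ′ k≢k′ same-index =
  k≢k′ (⋖-vertex-unique r⋖σ (subst (r ⋖⟨ k′ ⟩_) σ′≡σ r⋖σ′))
  where
  σ′≡σ = trans (Any.lookup-index σ′∈F) (trans (cong (lookup F) (sym same-index)) (sym (Any.lookup-index σ∈F)))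

boundary-isCycle : (rs F : List (Subset m)) → Unique F →
                   (τ : Subset m) → (∀ {σ k} → σ ⋖⟨ k ⟩ τ → σ ∈ F) →
                   Columns.IsCycle rs F (λ i → coeff (lookup F i) τ)
boundary-isCycle rs F F-unique τ faces∈F {r} _ = vanishes (Fin.any? λ i → ¬? (term i ℤ.≟ + 0))
  where
  term : Fin (length F) → ℤ
  term i = coeff (lookup F i) τ ℤ.* coeff r (lookup F i)
  chain : ∀ i → term i ≢ + 0 → (∃ λ j → r ⋖⟨ j ⟩ lookup F i) × (∃ λ k → lookup F i ⋖⟨ k ⟩ τ)
  chain i ti≢0 = coeff≢0⇒⋖ r (lookup F i) (*≢0ʳ (coeff (lookup F i) τ) _ ti≢0)
               , coeff≢0⇒⋖ (lookup F i) τ (*≢0ˡ _ (coeff r (lookup F i)) ti≢0)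
  vanishes : Dec (∃ λ i → term i ≢ + 0) → sumᶠ term ≡ + 0
  vanishes (no all-zero) = sumᶠ-zero term λ i → decidable-stable (term i ℤ.≟ + 0) (λ ti≢0 → all-zero (i , ti≢0))
  vanishes (yes (i₀ , ti₀≢0)) with chain i₀ ti₀≢0
  ... | (j , r⋖σ₀) , (k , σ₀⋖τ) with ⋖-commute r⋖σ₀ σ₀⋖τ
  ... | σ₁ , r⋖σ₁ , σ₁⋖τ = begin
    sumᶠ term                              ≡⟨ sumᶠ-support term (unique-pair i₀≢i₁) support ⟩
    term i₀ ℤ.+ (term i₁ ℤ.+ + 0)          ≡⟨ cong (ℤ._+_ (term i₀)) (ℤ.+-identityʳ (term i₁)) ⟩
    term i₀ ℤ.+ term i₁                    ≡⟨ cong (λ σ → term i₀ ℤ.+ coeff σ τ ℤ.* coeff r σ) Fi₁≡σ₁ ⟩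
    term i₀ ℤ.+ coeff σ₁ τ ℤ.* coeff r σ₁  ≡⟨ ∂∂-diamond r⋖σ₀ σ₀⋖τ r⋖σ₁ σ₁⋖τ ⟩
    + 0                                    ∎
    where
    open ≡-Reasoning
    i₁ : Fin (length F)
    i₁ = Any.index (faces∈F σ₁⋖τ)
    Fi₁≡σ₁ : lookup F i₁ ≡ σ₁
    Fi₁≡σ₁ = sym (Any.lookup-index (faces∈F σ₁⋖τ))
    i₀≢i₁ : i₀ ≢ i₁
    i₀≢i₁ refl =
      ⋖⋖-distinct r⋖σ₀ σ₀⋖τ (⋖-vertex-unique r⋖σ₀ (subst (r ⋖⟨ k ⟩_) (sym Fi₁≡σ₁) r⋖σ₁))
    support : ∀ i → term i ≢ + 0 → i ∈ i₀ ∷ i₁ ∷ []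
    support i ti≢0 with chain i ti≢0
    ... | (_ , r⋖σ) , (_ , σ⋖τ) with ⋖⋖-vertex r⋖σ₀ σ₀⋖τ r⋖σ σ⋖τ
    ... | inj₁ refl = here (lookup-injective F-unique i i₀ (⋖-functional r⋖σ r⋖σ₀))
    ... | inj₂ refl = there (here (coface-index F-unique (faces∈F σ₁⋖τ) r⋖σ₁ r⋖σ))

facets-unique : (Δ : Complex) (d : ℕ) → Unique (facets Δ d)
facets-unique Δ d = Unique.filter⁺ _ (unique Δ)

on-cycles⇒bridgeless : (Δ : Complex) (d : ℕ) →
                       (∀ j → ∃ λ z → Columns.IsCycle (ridges Δ d) (facets Δ d) z × z j ≢ + 0) → Bridgeless Δ d
on-cycles⇒bridgeless Δ d on-cycle f
  (f∈F , b , (r₁ , r₂ , rank₁ , rank₂ , betti) , (r₁′ , r₂′ , rank₁′ , rank₂′ , betti′))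
  with on-cycle (Any.index f∈F)
... | z , cycle , zj≢0 =
  Columns.cycle-column-keeps-rank (ridges Δ d) F (facets-unique Δ d) z cycle zj≢0
    (subst (HasRank (ridges Δ d) F) r₂≡1+r₂′ rank₂)
    (subst (λ g → HasRank (ridges Δ d) (removeFacet g F) r₂′) (Any.lookup-index f∈F) rank₂′)
  where
  F = facets Δ d
  r₂≡1+r₂′ : r₂ ≡ suc r₂′
  r₂≡1+r₂′ = ℕ.+-cancelˡ-≡ (b + r₁) r₂ (suc r₂′) (begin
    b + r₁ + r₂        ≡⟨ trans betti (sym betti′) ⟩
    suc b + r₁′ + r₂′  ≡⟨ cong (λ r → suc b + r + r₂′) (HasRank-unique rank₁′ rank₁) ⟩
    suc (b + r₁ + r₂′) ≡⟨ ℕ.+-suc (b + r₁) r₂′ ⟨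
    b + r₁ + suc r₂′   ∎)
    where open ≡-Reasoning

-- Skeleta of a simplex

allSubsets : ∀ m → List (Subset m)
allSubsets zero    = [] ∷ []
allSubsets (suc m) = List.map (inside ∷_) (allSubsets m) ++ List.map (outside ∷_) (allSubsets m)

∈-allSubsets : (σ : Subset m) → σ ∈ allSubsets m
∈-allSubsets []                  = here refl
∈-allSubsets (true ∷ σ)          = ∈-++⁺ˡ (∈-map⁺ (inside ∷_) (∈-allSubsets σ))
∈-allSubsets {suc m} (false ∷ σ) =
  ∈-++⁺ʳ (List.map (inside ∷_) (allSubsets m)) (∈-map⁺ (outside ∷_) (∈-allSubsets σ))

allSubsets-unique : ∀ m → Unique (allSubsets m)
allSubsets-unique zero    = All.[] AllPairs.∷ AllPairs.[]
allSubsets-unique (suc m) =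
  Unique.++⁺ (Unique.map⁺ Vec.∷-injectiveʳ (allSubsets-unique m))
             (Unique.map⁺ Vec.∷-injectiveʳ (allSubsets-unique m)) disjoint
  where
  disjoint : ∀ {σ} → ¬ (σ ∈ List.map (inside ∷_) (allSubsets m) × σ ∈ List.map (outside ∷_) (allSubsets m))
  disjoint (σ∈ins , σ∈outs) with ∈-map⁻ (inside ∷_) σ∈ins | ∈-map⁻ (outside ∷_) σ∈outs
  ... | _ , _ , refl | _ , _ , ()

skeleton : ℕ → ℕ → Complex
skeleton m d = record
  { n      = m
  ; faces  = filter (λ σ → ∣ σ ∣ ℕ.≤? suc d) (allSubsets m)
  ; unique = Unique.filter⁺ _ (allSubsets-unique m)
  ; closed = λ σ∈ τ⊆σ → ∈-filter⁺ _ (∈-allSubsets _)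
               (ℕ.≤-trans (Subset.p⊆q⇒∣p∣≤∣q∣ τ⊆σ)
                          (proj₂ (∈-filter⁻ (λ σ → ∣ σ ∣ ℕ.≤? suc d) {xs = allSubsets m} σ∈)))
  }

∈-facesOfSize⁻ : (Δ : Complex) {k : ℕ} {σ : Subset (n Δ)} → σ ∈ facesOfSize Δ k → ∣ σ ∣ ≡ k
∈-facesOfSize⁻ Δ σ∈ = proj₂ (∈-filter⁻ _ {xs = faces Δ} σ∈)

∈-skeleton-facesOfSize : {d k : ℕ} (σ : Subset m) → k ≤ suc d → ∣ σ ∣ ≡ k →
                         σ ∈ facesOfSize (skeleton m d) k
∈-skeleton-facesOfSize σ k≤1+d refl = ∈-filter⁺ _ (∈-filter⁺ _ (∈-allSubsets σ) k≤1+d) refl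

skeleton-hasDim : {d : ℕ} (σ : Subset m) → ∣ σ ∣ ≡ suc d → HasDim (skeleton m d) d
skeleton-hasDim {m} {d} σ ∣σ∣ =
  (λ τ∈ → proj₂ (∈-filter⁻ (λ τ → ∣ τ ∣ ℕ.≤? suc d) {xs = allSubsets m} τ∈)) ,
  σ , ∈-filter⁺ _ (∈-allSubsets σ) (ℕ.≤-reflexive ∣σ∣) , ∣σ∣

skeleton-bridgeless : {d : ℕ} → suc d < m → Bridgeless (skeleton m d) d
skeleton-bridgeless {m} {d} 1+d<m = on-cycles⇒bridgeless (skeleton m d) d on-boundary
  where
  F = facets (skeleton m d) d
  on-boundary : ∀ j → ∃ λ z → Columns.IsCycle (ridges (skeleton m d) d) F z × z j ≢ + 0
  on-boundary j with ∃-outside (lookup F j) (subst (_< m) (sym (∈-facesOfSize⁻ (skeleton m d) (∈-lookup j))) 1+d<m)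
  ... | u , fu = (λ i → coeff (lookup F i) τ)
               , boundary-isCycle _ F (facets-unique (skeleton m d) d) τ face∈F
               , λ zj≡0 → sgn≢0 (before (lookup F j) u) (trans (sym (coeff-⋖ f⋖τ)) zj≡0)
    where
    τ = lookup F j [ u ]≔ inside
    f⋖τ : lookup F j ⋖⟨ u ⟩ τ
    f⋖τ = add fu
    face∈F : ∀ {σ k} → σ ⋖⟨ k ⟩ τ → σ ∈ F
    face∈F {σ} σ⋖τ = ∈-skeleton-facesOfSize σ ℕ.≤-refl (ℕ.suc-injective (begin
      suc ∣ σ ∣          ≡⟨ ∣⋖∣ σ⋖τ ⟨
      ∣ τ ∣              ≡⟨ ∣⋖∣ f⋖τ ⟩
      suc ∣ lookup F j ∣ ≡⟨ cong suc (∈-facesOfSize⁻ (skeleton m d) (∈-lookup j)) ⟩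
      suc (suc d)        ∎))
      where open ≡-Reasoning

-- Faces of a simplex by their omitted vertices

avoid : List (Fin m) → Subset m
avoid []       = ⊤
avoid (k ∷ ks) = avoid ks [ k ]≔ outside

avoid-∉ : {k : Fin m} (ks : List (Fin m)) → k ∉ ks → Vec.lookup (avoid ks) k ≡ inside
avoid-∉ {k = k} []        _    = Vec.lookup-replicate k inside
avoid-∉ {k = k} (k′ ∷ ks) k∉ks =
  trans (Vec.lookup∘update′ (k∉ks ∘ here) (avoid ks) outside) (avoid-∉ ks (k∉ks ∘ there))

avoid-outside⇒∈ : {k : Fin m} (ks : List (Fin m)) → Vec.lookup (avoid ks) k ≡ outside → k ∈ ks
avoid-outside⇒∈ {k = k} ks ks-k =
  decidable-stable (Any.any? (k Fin.≟_) ks) λ k∉ks → case trans (sym (avoid-∉ ks k∉ks)) ks-k of λ ()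

avoid-⋖ : {k : Fin m} (ks : List (Fin m)) → k ∉ ks → avoid (k ∷ ks) ⋖⟨ k ⟩ avoid ks
avoid-⋖ {k = k} ks k∉ks = ⋖-remove (avoid ks) k (avoid-∉ ks k∉ks)

avoid-swap : {a b : Fin m} (ks : List (Fin m)) → a ≢ b → avoid (a ∷ b ∷ ks) ≡ avoid (b ∷ a ∷ ks)
avoid-swap {a = a} {b} ks a≢b = Vec.[]≔-commutes (avoid ks) b a (a≢b ∘ sym)

∣avoid∣ : (ks : List (Fin m)) → Unique ks → length ks + ∣ avoid ks ∣ ≡ m
∣avoid∣ {m} []       _ = Subset.∣⊤∣≡n m
∣avoid∣ {m} (k ∷ ks) distinct@(_ AllPairs.∷ distinct′) = begin
  suc (length ks + ∣ avoid (k ∷ ks) ∣)  ≡⟨ ℕ.+-suc (length ks) _ ⟨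
  length ks + suc (∣ avoid (k ∷ ks) ∣)  ≡⟨ cong (_+_ (length ks)) (∣⋖∣ k⋖) ⟨
  length ks + ∣ avoid ks ∣              ≡⟨ ∣avoid∣ ks distinct′ ⟩
  m                                     ∎
  where
  open ≡-Reasoning
  k⋖ = avoid-⋖ ks (Unique.Unique[x∷xs]⇒x∉xs distinct)

∣avoid-pair∣ : {d : ℕ} {a b : Fin (3 + d)} → a ≢ b → ∣ avoid (a ∷ b ∷ []) ∣ ≡ suc d
∣avoid-pair∣ {a = a} {b} a≢b =
  ℕ.suc-injective (ℕ.suc-injective (∣avoid∣ (a ∷ b ∷ []) (unique-pair a≢b)))

∉-pair : {k a b : Fin m} → k ≢ a → k ≢ b → k ∉ a ∷ b ∷ []
∉-pair k≢a k≢b (here k≡a)         = k≢a k≡a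
∉-pair k≢a k≢b (there (here k≡b)) = k≢b k≡b

module Ridge {m : ℕ} {u v : Fin m} (u<v : u Fin.< v) where

  u⁺ v⁺ : Fin (suc m)
  u⁺ = Fin.suc u
  v⁺ = Fin.suc v

  R : Subset (suc m)
  R = avoid (0F ∷ u⁺ ∷ v⁺ ∷ [])

  0≢u : 0F ≢ u⁺
  0≢u = Fin.0≢1+n

  0≢v : 0F ≢ v⁺
  0≢v = Fin.0≢1+n

  u≢v : u⁺ ≢ v⁺
  u≢v = Fin.<⇒≢ (s≤s u<v)

  R⋖₀ : R ⋖⟨ 0F ⟩ avoid (u⁺ ∷ v⁺ ∷ [])
  R⋖₀ = avoid-⋖ (u⁺ ∷ v⁺ ∷ []) (∉-pair 0≢u 0≢v)

  R⋖ᵤ : R ⋖⟨ u⁺ ⟩ avoid (0F ∷ v⁺ ∷ [])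
  R⋖ᵤ = subst (_⋖⟨ u⁺ ⟩ avoid (0F ∷ v⁺ ∷ [])) (avoid-swap (v⁺ ∷ []) (0≢u ∘ sym))
              (avoid-⋖ (0F ∷ v⁺ ∷ []) (∉-pair (0≢u ∘ sym) u≢v))

  R⋖ᵥ : R ⋖⟨ v⁺ ⟩ avoid (0F ∷ u⁺ ∷ [])
  R⋖ᵥ = subst (_⋖⟨ v⁺ ⟩ avoid (0F ∷ u⁺ ∷ [])) R≡
              (avoid-⋖ (0F ∷ u⁺ ∷ []) (∉-pair (0≢v ∘ sym) (u≢v ∘ sym)))
    where
    R≡ : avoid (v⁺ ∷ 0F ∷ u⁺ ∷ []) ≡ R
    R≡ = trans (avoid-swap (u⁺ ∷ []) (0≢v ∘ sym)) (cong (_[ 0F ]≔ outside) (avoid-swap [] (u≢v ∘ sym)))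

  R-outside : {k : Fin (suc m)} → Vec.lookup R k ≡ outside → k ≡ 0F ⊎ k ≡ u⁺ ⊎ k ≡ v⁺
  R-outside Rk with avoid-outside⇒∈ (0F ∷ u⁺ ∷ v⁺ ∷ []) Rk
  ... | here k≡0                 = inj₁ k≡0
  ... | there (here k≡u)         = inj₂ (inj₁ k≡u)
  ... | there (there (here k≡v)) = inj₂ (inj₂ k≡v)

  ∣R∣ : 3 + ∣ R ∣ ≡ suc m
  ∣R∣ = ∣avoid∣ (0F ∷ u⁺ ∷ v⁺ ∷ []) (unique-triple 0≢u 0≢v u≢v)

  private
    uv⋖v : avoid (u⁺ ∷ v⁺ ∷ []) ⋖⟨ u⁺ ⟩ avoid (v⁺ ∷ [])
    uv⋖v = avoid-⋖ (v⁺ ∷ []) λ { (here u≡v) → u≢v u≡v }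
    v⋖⊤ : avoid (v⁺ ∷ []) ⋖⟨ v⁺ ⟩ ⊤
    v⋖⊤ = avoid-⋖ [] λ ()

  coeff₀ : coeff R (avoid (u⁺ ∷ v⁺ ∷ [])) ≡ + 1
  coeff₀ = coeff-⋖ R⋖₀

  coeffᵤ : coeff R (avoid (0F ∷ v⁺ ∷ [])) ≡ sgn (toℕ u)
  coeffᵤ = trans (coeff-⋖ R⋖ᵤ) (cong sgn (ℕ.suc-injective (begin
    suc (before R u⁺)                     ≡⟨ before-⋖-> u⁺ R⋖₀ (s≤s z≤n) ⟨
    before (avoid (u⁺ ∷ v⁺ ∷ [])) u⁺      ≡⟨ before-⋖-≤ u⁺ uv⋖v ℕ.≤-refl ⟨
    before (avoid (v⁺ ∷ [])) u⁺           ≡⟨ before-⋖-≤ u⁺ v⋖⊤ (s≤s (ℕ.<⇒≤ u<v)) ⟨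
    before ⊤ u⁺                           ≡⟨ before-⊤ u⁺ ⟩
    suc (toℕ u)                           ∎)))
    where open ≡-Reasoning

  coeffᵥ : coeff R (avoid (0F ∷ u⁺ ∷ [])) ≡ - sgn (toℕ v)
  coeffᵥ = trans (coeff-⋖ R⋖ᵥ) (trans (sym (ℤ.neg-involutive _)) (cong (-_ ∘ sgn) (ℕ.suc-injective (begin
    suc (suc (before R v⁺))                  ≡⟨ cong suc (before-⋖-> v⁺ R⋖₀ (s≤s z≤n)) ⟨
    suc (before (avoid (u⁺ ∷ v⁺ ∷ [])) v⁺)   ≡⟨ before-⋖-> v⁺ uv⋖v (s≤s u<v) ⟨
    before (avoid (v⁺ ∷ [])) v⁺              ≡⟨ before-⋖-≤ v⁺ v⋖⊤ ℕ.≤-refl ⟨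
    before ⊤ v⁺                              ≡⟨ before-⊤ v⁺ ⟩
    suc (toℕ v)                              ∎))))
    where open ≡-Reasoning

-- Flows on the d-skeleton of the (d + 2)-simplex

*-unit : (s t : ℤ) → s ℤ.* s ≡ + 1 → t ℤ.* t ≡ + 1 → s ℤ.* t ℤ.* (s ℤ.* t) ≡ + 1
*-unit s t s²≡1 t²≡1 =
  trans (solve 2 (λ s t → s :* t :* (s :* t) := s :* s :* (t :* t)) refl s t) (cong₂ ℤ._*_ s²≡1 t²≡1)

∣-unit : {k x : ℤ} (ε : ℤ) → ε ℤ.* ε ≡ + 1 → k ∣ ε ℤ.* x → k ∣ x
∣-unit {k} {x} ε ε²≡1 k∣εx = subst (k ∣_) εεx≡x (∣n⇒∣m*n ε k∣εx)
  where
  εεx≡x : ε ℤ.* (ε ℤ.* x) ≡ x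
  εεx≡x = trans (sym (ℤ.*-assoc ε ε x)) (trans (cong (ℤ._* x) ε²≡1) (ℤ.*-identityˡ x))

%ℕ-≡⇒∣- : (q : ℕ) .{{_ : ℕ.NonZero q}} (a b : ℤ) → a %ℕ q ≡ b %ℕ q → + q ∣ a ℤ.- b
%ℕ-≡⇒∣- q a b same = divides (a /ℕ q ℤ.- b /ℕ q) (begin
  a ℤ.- b
    ≡⟨ cong₂ ℤ._-_ (a≡a%ℕn+[a/ℕn]*n a q) (a≡a%ℕn+[a/ℕn]*n b q) ⟩
  (+ (a %ℕ q) ℤ.+ a /ℕ q ℤ.* + q) ℤ.- (+ (b %ℕ q) ℤ.+ b /ℕ q ℤ.* + q)
    ≡⟨ cong (λ r → (+ (a %ℕ q) ℤ.+ a /ℕ q ℤ.* + q) ℤ.- (+ r ℤ.+ b /ℕ q ℤ.* + q)) same ⟨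
  (+ (a %ℕ q) ℤ.+ a /ℕ q ℤ.* + q) ℤ.- (+ (a %ℕ q) ℤ.+ b /ℕ q ℤ.* + q)
    ≡⟨ solve 4 (λ r x y z → (r :+ x :* z) :- (r :+ y :* z) := (x :- y) :* z)
               refl (+ (a %ℕ q)) (a /ℕ q) (b /ℕ q) (+ q) ⟩
  (a /ℕ q ℤ.- b /ℕ q) ℤ.* + q ∎)
  where open ≡-Reasoning

potential-identity : ∀ s t a b c → s ℤ.* s ≡ + 1 → t ℤ.* t ≡ + 1 →
                     s ℤ.* c ℤ.- t ℤ.* b ℤ.+ s ℤ.* t ℤ.* (a ℤ.+ s ℤ.* b ℤ.- t ℤ.* c) ≡ s ℤ.* t ℤ.* a
potential-identity s t a b c s²≡1 t²≡1 = begin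
  s ℤ.* c ℤ.- t ℤ.* b ℤ.+ s ℤ.* t ℤ.* (a ℤ.+ s ℤ.* b ℤ.- t ℤ.* c)
    ≡⟨ solve 5 (λ s t a b c → s :* c :- t :* b :+ s :* t :* (a :+ s :* b :- t :* c)
                            := s :* t :* a :+ t :* b :* (s :* s :- con (+ 1)) :+ s :* c :* (con (+ 1) :- t :* t))
               refl s t a b c ⟩
  s ℤ.* t ℤ.* a ℤ.+ t ℤ.* b ℤ.* (s ℤ.* s ℤ.- + 1) ℤ.+ s ℤ.* c ℤ.* (+ 1 ℤ.- t ℤ.* t)
    ≡⟨ cong₂ (λ x y → s ℤ.* t ℤ.* a ℤ.+ t ℤ.* b ℤ.* (x ℤ.- + 1) ℤ.+ s ℤ.* c ℤ.* (+ 1 ℤ.- y))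
             s²≡1 t²≡1 ⟩
  s ℤ.* t ℤ.* a ℤ.+ t ℤ.* b ℤ.* (+ 1 ℤ.- + 1) ℤ.+ s ℤ.* c ℤ.* (+ 1 ℤ.- + 1)
    ≡⟨ solve 5 (λ s t a b c → s :* t :* a :+ t :* b :* (con (+ 1) :- con (+ 1)) :+ s :* c :* (con (+ 1) :- con (+ 1))
                            := s :* t :* a) refl s t a b c ⟩
  s ℤ.* t ℤ.* a ∎
  where open ≡-Reasoning

module SimplexSkeletonFlow {d q : ℕ} (flow : NZFlow (skeleton (3 + d) d) d q) where

  F : List (Subset (3 + d))
  F = facets (skeleton (3 + d) d) d

  φ : Fin (length F) → ℤ
  φ i = + toℕ (proj₁ flow i)

  ¬q∣φ : ∀ i → ¬ (+ q ∣ φ i)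
  ¬q∣φ i q∣φi =
    ℕ.<⇒≱ (Fin.toℕ<n (proj₁ flow i)) (ℕ.∣⇒≤ ⦃ ℕ.≢-nonZero (proj₁ (proj₂ flow) i) ⦄ (∣⇒∣ᵤ q∣φi))

  edge∈F : {a b : Fin (3 + d)} → a ≢ b → avoid (a ∷ b ∷ []) ∈ F
  edge∈F a≢b = ∈-skeleton-facesOfSize _ ℕ.≤-refl (∣avoid-pair∣ a≢b)

  edge : {a b : Fin (3 + d)} → a ≢ b → Fin (length F)
  edge a≢b = Any.index (edge∈F a≢b)

  lookup-edge : {a b : Fin (3 + d)} (a≢b : a ≢ b) → lookup F (edge a≢b) ≡ avoid (a ∷ b ∷ [])
  lookup-edge a≢b = sym (Any.lookup-index (edge∈F a≢b))

  potential : Fin (3 + d) → ℤ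
  potential 0F          = + 0
  potential (Fin.suc x) = sgn (toℕ x) ℤ.* φ (edge (Fin.0≢1+n {i = x}))

  ridge-relation : {u v : Fin (2 + d)} (u<v : u Fin.< v) → let open Ridge u<v in
                   + q ∣ φ (edge u≢v) ℤ.+ sgn (toℕ u) ℤ.* φ (edge 0≢v) ℤ.- sgn (toℕ v) ℤ.* φ (edge 0≢u)
  ridge-relation {u} {v} u<v = subst (+ q ∣_) sum≡ (∣ᵤ⇒∣ (proj₂ (proj₂ flow) R∈ridges))
    where
    open Ridge u<v
    F-unique = facets-unique (skeleton (3 + d) d) d
    R∈ridges : R ∈ ridges (skeleton (3 + d) d) d
    R∈ridges = ∈-skeleton-facesOfSize R (ℕ.n≤1+n d) (ℕ.suc-injective (ℕ.suc-injective (ℕ.suc-injective ∣R∣)))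
    term : Fin (length F) → ℤ
    term i = coeff R (lookup F i) ℤ.* φ i
    distinct : Unique (edge u≢v ∷ edge 0≢v ∷ edge 0≢u ∷ [])
    distinct = unique-triple (coface-index-distinct (edge∈F u≢v) (edge∈F 0≢v) R⋖₀ R⋖ᵤ 0≢u)
                             (coface-index-distinct (edge∈F u≢v) (edge∈F 0≢u) R⋖₀ R⋖ᵥ 0≢v)
                             (coface-index-distinct (edge∈F 0≢v) (edge∈F 0≢u) R⋖ᵤ R⋖ᵥ u≢v)
    support : ∀ i → term i ≢ + 0 → i ∈ edge u≢v ∷ edge 0≢v ∷ edge 0≢u ∷ []
    support i ti≢0 with coeff≢0⇒⋖ R (lookup F i) (*≢0ˡ _ (φ i) ti≢0)
    ... | k , R⋖Fi with R-outside {k = k} (⋖-old R⋖Fi)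
    ... | inj₁ refl        = here (coface-index F-unique (edge∈F u≢v) R⋖₀ R⋖Fi)
    ... | inj₂ (inj₁ refl) = there (here (coface-index F-unique (edge∈F 0≢v) R⋖ᵤ R⋖Fi))
    ... | inj₂ (inj₂ refl) = there (there (here (coface-index F-unique (edge∈F 0≢u) R⋖ᵥ R⋖Fi)))
    coeff-edge : ∀ {a b x} (a≢b : a ≢ b) → coeff R (avoid (a ∷ b ∷ [])) ≡ x → coeff R (lookup F (edge a≢b)) ≡ x
    coeff-edge a≢b = trans (cong (coeff R) (lookup-edge a≢b))
    a = φ (edge u≢v)
    b = φ (edge 0≢v)
    c = φ (edge 0≢u)
    sum≡ : sumᶠ term ≡ a ℤ.+ sgn (toℕ u) ℤ.* b ℤ.- sgn (toℕ v) ℤ.* c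
    sum≡ = begin
      sumᶠ term
        ≡⟨ sumᶠ-support term distinct support ⟩
      term (edge u≢v) ℤ.+ (term (edge 0≢v) ℤ.+ (term (edge 0≢u) ℤ.+ + 0))
        ≡⟨ cong₂ ℤ._+_ (cong (ℤ._* a) (coeff-edge u≢v coeff₀))
                       (cong₂ ℤ._+_ (cong (ℤ._* b) (coeff-edge 0≢v coeffᵤ))
                                    (cong (λ x → x ℤ.* c ℤ.+ + 0) (coeff-edge 0≢u coeffᵥ))) ⟩
      + 1 ℤ.* a ℤ.+ (sgn (toℕ u) ℤ.* b ℤ.+ ((- sgn (toℕ v)) ℤ.* c ℤ.+ + 0))
        ≡⟨ solve 5 (λ a b c s t → con (+ 1) :* a :+ (s :* b :+ ((:- t) :* c :+ con (+ 0))) := a :+ s :* b :- t :* c)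
                   refl a b c (sgn (toℕ u)) (sgn (toℕ v)) ⟩
      a ℤ.+ sgn (toℕ u) ℤ.* b ℤ.- sgn (toℕ v) ℤ.* c
        ∎
      where open ≡-Reasoning

  potential-separates : {i j : Fin (3 + d)} → i Fin.< j → ¬ (+ q ∣ potential i ℤ.- potential j)
  potential-separates {0F} {Fin.suc v} _ q∣ =
    ¬q∣φ (edge 0≢v) (∣-unit (sgn (toℕ v)) (sgn*sgn≡1 (toℕ v)) (subst (+ q ∣_) -[0-x]≡x (∣m⇒∣-m q∣)))
    where
    0≢v = Fin.0≢1+n {i = v}
    x = sgn (toℕ v) ℤ.* φ (edge 0≢v)
    -[0-x]≡x : - (+ 0 ℤ.- x) ≡ x
    -[0-x]≡x = trans (cong -_ (ℤ.+-identityˡ (- x))) (ℤ.neg-involutive x)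
  potential-separates {Fin.suc u} {Fin.suc v} (s≤s u<v) q∣ =
    ¬q∣φ (edge u≢v) (∣-unit (s ℤ.* t) (*-unit s t s² t²)
      (subst (+ q ∣_) (potential-identity s t (φ (edge u≢v)) (φ (edge 0≢v)) (φ (edge 0≢u)) s² t²)
        (∣m∣n⇒∣m+n q∣ (∣n⇒∣m*n (s ℤ.* t) (ridge-relation u<v)))))
    where
    open Ridge u<v
    s = sgn (toℕ u)
    t = sgn (toℕ v)
    s² = sgn*sgn≡1 (toℕ u)
    t² = sgn*sgn≡1 (toℕ v)

skeleton-¬NZFlow : (d q : ℕ) → q ≤ 2 + d → ¬ NZFlow (skeleton (3 + d) d) d q
skeleton-¬NZFlow d zero    _     flow = case proj₁ flow (SimplexSkeletonFlow.edge flow (Fin.0≢1+n {i = 0F})) of λ ()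
skeleton-¬NZFlow d (suc q) q<3+d flow with Fin.pigeonhole (s≤s q<3+d) residue
  where
  open SimplexSkeletonFlow flow using (potential)
  residue : Fin (3 + d) → Fin (suc q)
  residue x = Fin.fromℕ< (n%ℕd<d (potential x) (suc q))
... | i , j , i<j , same-residue =
  potential-separates i<j (%ℕ-≡⇒∣- (suc q) (potential i) (potential j) (Fin.fromℕ<-injective _ _ _ _ same-residue))
  where open SimplexSkeletonFlow flow using (potential; potential-separates)

-- The construction works for every d.
theorem1p3 : (d : ℕ) → 1 ≤ d → (κ : ℕ) → Admissible d κ → d + 2 < κ
theorem1p3 d _ κ admissible = decidable-stable (d + 2 ℕ.<? κ) λ d+2≮κ →
  let q , _ , q≤κ , flow = admissible Δ (skeleton-hasDim facet ∣facet∣) (skeleton-bridgeless (ℕ.n≤1+n _))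
  in  skeleton-¬NZFlow d q (ℕ.≤-trans q≤κ (subst (κ ≤_) (ℕ.+-comm d 2) (ℕ.≮⇒≥ d+2≮κ))) flow
  where
  Δ = skeleton (3 + d) d
  facet = avoid (0F ∷ Fin.suc 0F ∷ [])
  ∣facet∣ : ∣ facet ∣ ≡ suc d
  ∣facet∣ = ∣avoid-pair∣ {a = 0F} {b = Fin.suc 0F} Fin.0≢1+n
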